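{- Let $G=\{1_G,\alpha,\beta,\gamma\}$ be the Klein four group acting on a finite set $X$ such that no orbit has length 4. Let $X_{\alpha,1},\dots,X_{\alpha,p}$ be the orbits of length 2 on which $\alpha$ acts trivially, $X_{\beta,1},\dots,X_{\beta,q}$ those on which $\beta$ acts trivially, and $X_{\gamma,1},\dots,X_{\gamma,r}$ those on which $\gamma$ acts trivially (any of $p,q,r$ may be 0; the remaining orbits have length 1). For $f:X\to\mathbb F_2$ let $\mu_\alpha=|\{i\le p: |f^{ -1}(1)\cap X_{\alpha,i}|=1\}|$, $\mu_\beta=|\{i\le q: |f^{ -1}(1)\cap X_{\beta,i}|=1\}|$, $\mu_\gamma=|\{i\le r: |f^{ -1}(1)\cap X_{\gamma,i}|=1\}|$. Then: (i) there exists a $G$-perfect nonlinear function $X\to\mathbb F_2$ if and only if $8\mid |X|$ and $\min\{p,q,r\}\ge |X|/8$; (ii) a function $f:X\to\mathbb F_2$ is $G$-perfect nonlinear if and only if $\mu_\alpha=\mu_\beta=\mu_\gamma=|X|/8$.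
   Context: $\mathbb F_2$ is the additive group of order 2. A function $f:X\to\mathbb F_2$ is $G$-perfect nonlinear if $2$ divides $|X|$ and for every $\delta\in G\setminus\{1_G\}$ and every $\sigma\in\mathbb F_2$, $|\{x\in X: f(\delta x)-f(x)=\sigma\}|=|X|/2$. -}

module Defs where

open import Data.Nat using (ℕ; zero; suc; _+_; _*_; _≡ᵇ_; _/_; _⊓_; _≤_)
open import Data.Nat.Divisibility using (_∣_)
open import Data.Bool using (Bool; true; false; _∧_; _∨_; _xor_; if_then_else_; not)
open import Data.Fin using (Fin; zero; suc) renaming (_≤?_ to _≤ᶠ?_)
open import Data.Fin.Properties using () renaming (_≟_ to _≟ᶠ_)
open import Data.Product using (_×_; Σ)
open import Relation.Nullary using (¬_; ⌊_⌋)
open import Relation.Binary.PropositionalEquality using (_≡_; _≢_)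

data V4 : Set where
  e α β γ : V4

_·_ : V4 → V4 → V4
e · g = g
g · e = g
α · α = e
α · β = γ
α · γ = β
β · α = γ
β · β = e
β · γ = α
γ · α = β
γ · β = α
γ · γ = e

record Action (n : ℕ) : Set where
  field
    act      : V4 → Fin n → Fin n
    act-id   : ∀ x → act e x ≡ x
    act-comp : ∀ g h x → act (g · h) x ≡ act g (act h x)

countB : ∀ {n} → (Fin n → Bool) → ℕ
countB {zero}  P = 0
countB {suc n} P = (if P zero then 1 else 0) + countB (λ i → P (suc i))

_==ᵇ_ : Bool → Bool → Bool
a ==ᵇ b = not (a xor b)

module _ {n : ℕ} (A : Action n) where
  open Action A

  allG : (V4 → Bool) → Bool
  allG P = P e ∧ P α ∧ P β ∧ P γ

  anyG : (V4 → Bool) → Bool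
  anyG P = P e ∨ P α ∨ P β ∨ P γ

  inOrbit : Fin n → Fin n → Bool
  inOrbit x y = anyG (λ g → ⌊ act g x ≟ᶠ y ⌋)

  orbitSize : Fin n → ℕ
  orbitSize x = countB (inOrbit x)

  -- x is the canonical representative (the least element) of its orbit;
  -- orbits are counted through their representatives.
  isRep : Fin n → Bool
  isRep x = allG (λ g → ⌊ x ≤ᶠ? act g x ⌋)

  trivialOn : V4 → Fin n → Bool
  trivialOn g x = allG (λ h → ⌊ act g (act h x) ≟ᶠ act h x ⌋)

  isOrbitOfType : V4 → Fin n → Bool
  isOrbitOfType g x = isRep x ∧ (orbitSize x ≡ᵇ 2) ∧ trivialOn g x

  numOrbits : V4 → ℕ
  numOrbits g = countB (isOrbitOfType g)

  μ : V4 → (Fin n → Bool) → ℕ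
  μ g f = countB (λ x → isOrbitOfType g x ∧ (countB (λ y → inOrbit x y ∧ f y) ≡ᵇ 1))

  NoOrbitOfLength4 : Set
  NoOrbitOfLength4 = ∀ x → ¬ (orbitSize x ≡ 4)

  -- G-perfect nonlinearity of f : X → F₂ (F₂ = Bool, subtraction = xor)
  PerfectNonlinear : (Fin n → Bool) → Set
  PerfectNonlinear f =
    (2 ∣ n) × (∀ δ → δ ≢ e → ∀ σ →
      countB (λ x → (f (act δ x) xor f x) ==ᵇ σ) ≡ n / 2)

-- Without orbits of length 4, every orbit is a fixed point or a pair {x, z} whose stabiliser
-- is {1, g} for exactly one g ∈ {α, β, γ}, the type of the orbit. A non-identity δ moves exactly
-- the points of the pair orbits of the two other types h, k, and f(δx) ≠ f(x) on such an orbit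
-- iff f is non-constant on it; hence #{x : f(δx) − f(x) = 1} = 2(μ_h + μ_k). So f is perfect
-- nonlinear iff μ_β + μ_γ = μ_α + μ_γ = μ_α + μ_β = |X|/4, i.e. iff μ_α = μ_β = μ_γ = |X|/8.
-- Since μ_g is at most the number of orbits of type g, and marking one point in each of |X|/8
-- orbits of every type attains μ_g = |X|/8, this also settles existence.
module Submission where

open import Defs
open import Data.Bool using (Bool; true; false; _∧_; _∨_; _xor_; if_then_else_; not)
open import Data.Bool.Properties
  using (∧-comm; ∧-conicalˡ; ∧-zeroʳ; ∧-identityʳ; ∨-zeroʳ; ∨-identityʳ; xor-comm; xor-same; xor-identityʳ)
open import Data.Empty using (⊥-elim)
open import Data.Fin using (Fin; zero; suc) renaming (_≤_ to _≤ᶠ_)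
open import Data.Fin.Permutation using (permutation)
open import Data.Fin.Properties using (_≟_; _≤?_; ≤-refl; ≤-antisym; ≤-total; suc-injective)
open import Data.Nat using (ℕ; zero; suc; _+_; _*_; _/_; _⊓_; _≤_; _≡ᵇ_; z≤n; s≤s; NonZero)
open import Data.Nat.DivMod using (m*n/n≡m; m*[n/m]≡n)
open import Data.Nat.Divisibility using (_∣_; m∣m*n)
open import Data.Nat.Properties
  using (+-identityʳ; +-suc; +-mono-≤; +-cancelˡ-≡; +-cancelʳ-≡; *-comm; *-assoc; *-cancelˡ-≡; *-distribˡ-+;
         ⊓-glb; m≤n⇒m⊓n≡m; m≤n⊓o⇒m≤n; m≤n⊓o⇒m≤o; +-0-commutativeMonoid; +-commutativeSemigroup)
open import Data.Nat.Tactic.RingSolver using (solve-∀)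
open import Algebra.Properties.CommutativeSemigroup +-commutativeSemigroup
  using () renaming (interchange to +-interchange)
open import Algebra.Properties.CommutativeMonoid.Sum +-0-commutativeMonoid using (sum; sum-permute)
open import Data.Product using (_×_; _,_; Σ)
open import Data.Product.Function.NonDependent.Propositional using (_×-⇔_)
open import Data.Sum using (_⊎_; inj₁; inj₂; reduce)
import Data.Sum as Sum
open import Function using (_∘_)
open import Function.Bundles using (_⇔_; mk⇔; module Equivalence)
open import Function.Properties.Equivalence using () renaming (trans to ⇔-trans)
open import Relation.Nullary using (¬_; ⌊_⌋; yes; no)
open import Relation.Nullary.Decidable using (Dec; dec-true; dec-false; isYes≗does; ⌊⌋-map′)
open import Relation.Binary.PropositionalEquality

indicator : Bool → ℕ
indicator b = if b then 1 else 0

⌊⌋-true : ∀ {p} {P : Set p} (P? : Dec P) → P → ⌊ P? ⌋ ≡ true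
⌊⌋-true P? p = trans (isYes≗does P?) (dec-true P? p)

⌊⌋-false : ∀ {p} {P : Set p} (P? : Dec P) → ¬ P → ⌊ P? ⌋ ≡ false
⌊⌋-false P? ¬p = trans (isYes≗does P?) (dec-false P? ¬p)

countB-cong : ∀ {n} {P Q : Fin n → Bool} → (∀ x → P x ≡ Q x) → countB P ≡ countB Q
countB-cong {zero}  P≗Q = refl
countB-cong {suc n} P≗Q = cong₂ _+_ (cong indicator (P≗Q zero)) (countB-cong (P≗Q ∘ suc))

countB-+ : ∀ {n} {P Q R : Fin n → Bool} →
  (∀ x → indicator (P x) ≡ indicator (Q x) + indicator (R x)) → countB P ≡ countB Q + countB R
countB-+ {zero}              split = refl
countB-+ {suc n} {P} {Q} {R} split =
  trans (cong₂ _+_ (split zero) (countB-+ (split ∘ suc)))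
        (+-interchange (indicator (Q zero)) (indicator (R zero)) (countB (Q ∘ suc)) (countB (R ∘ suc)))

countB-mono : ∀ {n} {P Q : Fin n → Bool} → (∀ x → P x ≡ true → Q x ≡ true) → countB P ≤ countB Q
countB-mono {zero}          P⊆Q = z≤n
countB-mono {suc n} {P} {Q} P⊆Q with P zero in P₀
... | true  rewrite P⊆Q zero P₀ = s≤s (countB-mono (P⊆Q ∘ suc))
... | false = +-mono-≤ z≤n (countB-mono (P⊆Q ∘ suc))

countB-complement : ∀ {n} (P : Fin n → Bool) → countB P + countB (not ∘ P) ≡ n
countB-complement {zero}  P = refl
countB-complement {suc n} P with P zero
... | true  = cong suc (countB-complement (P ∘ suc))
... | false = trans (+-suc (countB (P ∘ suc)) _) (cong suc (countB-complement (P ∘ suc)))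

countB-false : ∀ {n} → countB {n} (λ _ → false) ≡ 0
countB-false {zero}  = refl
countB-false {suc n} = countB-false {n}

countB-≟-∧ : ∀ {n} (a : Fin n) (P : Fin n → Bool) → countB (λ y → ⌊ a ≟ y ⌋ ∧ P y) ≡ indicator (P a)
countB-≟-∧ {suc n} zero P = trans (cong (indicator (P zero) +_) (countB-false {n})) (+-identityʳ _)
countB-≟-∧ (suc a)     P =
  trans (countB-cong (λ y → cong (_∧ P (suc y)) (⌊⌋-map′ (cong suc) suc-injective (a ≟ y))))
        (countB-≟-∧ a (P ∘ suc))

countB-≟ : ∀ {n} (a : Fin n) → countB (λ y → ⌊ a ≟ y ⌋) ≡ 1
countB-≟ a = trans (countB-cong (λ y → sym (∧-identityʳ ⌊ a ≟ y ⌋))) (countB-≟-∧ a (λ _ → true))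

countB-≟-∨ : ∀ {n} (a : Fin n) (Q : Fin n → Bool) → Q a ≡ false →
  countB (λ y → ⌊ a ≟ y ⌋ ∨ Q y) ≡ suc (countB Q)
countB-≟-∨ a Q Qa≡false = trans (countB-+ split) (cong (_+ countB Q) (countB-≟ a))
  where
  split : ∀ y → indicator (⌊ a ≟ y ⌋ ∨ Q y) ≡ indicator ⌊ a ≟ y ⌋ + indicator (Q y)
  split y with a ≟ y
  ... | yes refl rewrite Qa≡false = refl
  ... | no  _    = refl

countB-two : ∀ {n} {x z : Fin n} → z ≢ x → (P : Fin n → Bool) →
  countB (λ y → (⌊ x ≟ y ⌋ ∨ ⌊ z ≟ y ⌋) ∧ P y) ≡ indicator (P x) + indicator (P z)
countB-two {x = x} {z} z≢x P = trans (countB-+ split) (cong₂ _+_ (countB-≟-∧ x P) (countB-≟-∧ z P))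
  where
  split : ∀ y → indicator ((⌊ x ≟ y ⌋ ∨ ⌊ z ≟ y ⌋) ∧ P y)
              ≡ indicator (⌊ x ≟ y ⌋ ∧ P y) + indicator (⌊ z ≟ y ⌋ ∧ P y)
  split y with x ≟ y
  ... | yes refl rewrite ⌊⌋-false (z ≟ x) z≢x = sym (+-identityʳ _)
  ... | no  _    = refl

countB-sum : ∀ {n} (P : Fin n → Bool) → countB P ≡ sum (indicator ∘ P)
countB-sum {zero}  P = refl
countB-sum {suc n} P = cong (indicator (P zero) +_) (countB-sum (P ∘ suc))

countB-∘-involution : ∀ {n} (σ : Fin n → Fin n) → (∀ x → σ (σ x) ≡ x) → (P : Fin n → Bool) →
  countB (P ∘ σ) ≡ countB P
countB-∘-involution σ σσ P = begin
  countB (P ∘ σ)                ≡⟨ countB-sum (P ∘ σ) ⟩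
  sum (indicator ∘ P ∘ σ)       ≡⟨ sum-permute (indicator ∘ P) (permutation σ σ σσ σσ) ⟨
  sum (indicator ∘ P)           ≡⟨ countB-sum P ⟨
  countB P                      ∎
  where open ≡-Reasoning

≤?-flip : ∀ {n} {a b : Fin n} → a ≢ b → ⌊ a ≤? b ⌋ ≡ not ⌊ b ≤? a ⌋
≤?-flip {a = a} {b} a≢b with a ≤? b | b ≤? a
... | yes a≤b | yes b≤a = ⊥-elim (a≢b (≤-antisym a≤b b≤a))
... | yes _   | no  _   = refl
... | no  _   | yes _   = refl
... | no  a≰b | no  b≰a with ≤-total a b
...   | inj₁ a≤b = ⊥-elim (a≰b a≤b)
...   | inj₂ b≤a = ⊥-elim (b≰a b≤a)

-- The support of P splits into the orbits {x, σ x}, each counted once by its smaller point.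
countB-involution-halves : ∀ {n} (σ : Fin n → Fin n) → (∀ x → σ (σ x) ≡ x) → (P : Fin n → Bool) →
  (∀ x → P (σ x) ≡ P x) → (∀ x → P x ≡ true → σ x ≢ x) →
  countB P ≡ 2 * countB (λ x → P x ∧ ⌊ x ≤? σ x ⌋)
countB-involution-halves σ σσ P Pσ≡P fixed-free = begin
  countB P                              ≡⟨ countB-+ split ⟩
  countB Below + countB (Below ∘ σ)     ≡⟨ cong (countB Below +_) (countB-∘-involution σ σσ Below) ⟩
  countB Below + countB Below           ≡⟨ cong (countB Below +_) (+-identityʳ (countB Below)) ⟨
  2 * countB Below                      ∎
  where
  open ≡-Reasoning
  Below : Fin _ → Bool
  Below x = P x ∧ ⌊ x ≤? σ x ⌋
  split : ∀ x → indicator (P x) ≡ indicator (Below x) + indicator (Below (σ x))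
  split x rewrite σσ x | Pσ≡P x with P x in Px
  ... | false = refl
  ... | true rewrite ≤?-flip (fixed-free x Px) with ⌊ x ≤? σ x ⌋
  ...   | true  = refl
  ...   | false = refl

takeTrues : ∀ {n} → ℕ → (Fin n → Bool) → Fin n → Bool
takeTrues zero    P x       = false
takeTrues (suc k) P zero    = P zero
takeTrues (suc k) P (suc x) = takeTrues (if P zero then k else suc k) (P ∘ suc) x

takeTrues-⊆ : ∀ {n} k (P : Fin n → Bool) x → P x ≡ false → takeTrues k P x ≡ false
takeTrues-⊆ zero    P x       Px≡false = refl
takeTrues-⊆ (suc k) P zero    Px≡false = Px≡false
takeTrues-⊆ (suc k) P (suc x) Px≡false = takeTrues-⊆ (if P zero then k else suc k) (P ∘ suc) x Px≡false

countB-takeTrues : ∀ {n} k (P : Fin n → Bool) → countB (takeTrues k P) ≡ k ⊓ countB P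
countB-takeTrues {n}     zero    P = countB-false {n}
countB-takeTrues {zero}  (suc k) P = refl
countB-takeTrues {suc n} (suc k) P with P zero
... | true  = cong suc (countB-takeTrues k (P ∘ suc))
... | false = countB-takeTrues (suc k) (P ∘ suc)

indicator-+≡ᵇ1 : ∀ a b → (indicator a + indicator b ≡ᵇ 1) ≡ a xor b
indicator-+≡ᵇ1 true  true  = refl
indicator-+≡ᵇ1 true  false = refl
indicator-+≡ᵇ1 false true  = refl
indicator-+≡ᵇ1 false false = refl

·-comm : ∀ g h → g · h ≡ h · g
·-comm e = λ { e → refl ; α → refl ; β → refl ; γ → refl }
·-comm α = λ { e → refl ; α → refl ; β → refl ; γ → refl }
·-comm β = λ { e → refl ; α → refl ; β → refl ; γ → refl }
·-comm γ = λ { e → refl ; α → refl ; β → refl ; γ → refl }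

·-self : ∀ g → g · g ≡ e
·-self e = refl
·-self α = refl
·-self β = refl
·-self γ = refl

m*n≡o⇒n≡o/m : ∀ m {n o} .{{_ : NonZero m}} → m * n ≡ o → n ≡ o / m
m*n≡o⇒n≡o/m m {n} m*n≡o = sym (trans (cong (_/ m) (trans (sym m*n≡o) (*-comm m n))) (m*n/n≡m n m))

pairSums⇔eighths : ∀ {n a b c} →
  (4 * (b + c) ≡ n × 4 * (a + c) ≡ n × 4 * (a + b) ≡ n) ⇔ (8 * a ≡ n × 8 * b ≡ n × 8 * c ≡ n)
pairSums⇔eighths {n} {a} {b} {c} = mk⇔ to from
  where
  eight≡4·2 : ∀ x → 8 * x ≡ 4 * (x + x)
  eight≡4·2 = solve-∀

  pairSum : ∀ {x y} → x ≡ a → y ≡ a → 8 * a ≡ n → 4 * (x + y) ≡ n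
  pairSum refl refl ea = trans (sym (eight≡4·2 a)) ea

  to : 4 * (b + c) ≡ n × 4 * (a + c) ≡ n × 4 * (a + b) ≡ n → 8 * a ≡ n × 8 * b ≡ n × 8 * c ≡ n
  to (bc , ac , ab) = eighth , trans (cong (8 *_) b≡a) eighth , trans (cong (8 *_) c≡a) eighth
    where
    b≡a : b ≡ a
    b≡a = +-cancelʳ-≡ c b a (*-cancelˡ-≡ (b + c) (a + c) 4 (trans bc (sym ac)))
    c≡a : c ≡ a
    c≡a = trans (+-cancelˡ-≡ a c b (*-cancelˡ-≡ (a + c) (a + b) 4 (trans ac (sym ab)))) b≡a
    eighth : 8 * a ≡ n
    eighth = trans (eight≡4·2 a) (subst (λ u → 4 * (a + u) ≡ n) b≡a ab)

  from : 8 * a ≡ n × 8 * b ≡ n × 8 * c ≡ n → 4 * (b + c) ≡ n × 4 * (a + c) ≡ n × 4 * (a + b) ≡ n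
  from (ea , eb , ec) = pairSum b≡a c≡a ea , pairSum refl c≡a ea , pairSum refl b≡a ea
    where
    b≡a : b ≡ a
    b≡a = *-cancelˡ-≡ b a 8 (trans eb (sym ea))
    c≡a : c ≡ a
    c≡a = *-cancelˡ-≡ c a 8 (trans ec (sym ea))

Balanced : ∀ {n} → (Fin n → Bool) → Set
Balanced {n} P = 2 * countB P ≡ n

balanced-not : ∀ {n} {P : Fin n → Bool} → Balanced P → Balanced (not ∘ P)
balanced-not {n} {P} balanced = +-cancelˡ-≡ n _ _ (begin
  n + 2 * countB (not ∘ P)               ≡⟨ cong (_+ 2 * countB (not ∘ P)) balanced ⟨
  2 * countB P + 2 * countB (not ∘ P)    ≡⟨ *-distribˡ-+ 2 (countB P) (countB (not ∘ P)) ⟨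
  2 * (countB P + countB (not ∘ P))      ≡⟨ cong (2 *_) (countB-complement P) ⟩
  2 * n                                  ≡⟨ cong (n +_) (+-identityʳ n) ⟩
  n + n                                  ∎)
  where open ≡-Reasoning

==ᵇ-true : ∀ b → (b ==ᵇ true) ≡ b
==ᵇ-true true  = refl
==ᵇ-true false = refl

==ᵇ-false : ∀ b → (b ==ᵇ false) ≡ not b
==ᵇ-false true  = refl
==ᵇ-false false = refl

balanced⇒half : ∀ {n} {P : Fin n → Bool} → Balanced P → ∀ σ → countB (λ x → P x ==ᵇ σ) ≡ n / 2
balanced⇒half {P = P} balanced true  = trans (countB-cong (==ᵇ-true ∘ P)) (m*n≡o⇒n≡o/m 2 balanced)
balanced⇒half {P = P} balanced false =
  trans (countB-cong (==ᵇ-false ∘ P)) (m*n≡o⇒n≡o/m 2 (balanced-not balanced))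

half⇒balanced : ∀ {n} {P : Fin n → Bool} → 2 ∣ n → countB (λ x → P x ==ᵇ true) ≡ n / 2 → Balanced P
half⇒balanced {P = P} 2∣n half =
  trans (cong (2 *_) (trans (sym (countB-cong (==ᵇ-true ∘ P))) half)) (m*[n/m]≡n 2∣n)

balanced⇒2∣n : ∀ {n} {P : Fin n → Bool} → Balanced P → 2 ∣ n
balanced⇒2∣n {P = P} balanced = subst (2 ∣_) balanced (m∣m*n (countB P))

data Others : V4 → V4 → V4 → Set where
  α-βγ : Others α β γ
  β-αγ : Others β α γ
  γ-αβ : Others γ α β

module _ {n : ℕ} (A : Action n) where
  open Action A

  allG-const : ∀ {P b} → (∀ g → P g ≡ b) → allG A P ≡ b
  allG-const {P} {true}  P≡b rewrite P≡b e | P≡b α | P≡b β | P≡b γ = refl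
  allG-const {P} {false} P≡b rewrite P≡b e = refl

  anyG-const : ∀ {P b} → (∀ g → P g ≡ b) → anyG A P ≡ b
  anyG-const {P} {true}  P≡b rewrite P≡b e = refl
  anyG-const {P} {false} P≡b rewrite P≡b e | P≡b α | P≡b β | P≡b γ = refl

  anyG-true : ∀ {P} g → P g ≡ true → anyG A P ≡ true
  anyG-true {P} e Pg≡true rewrite Pg≡true = refl
  anyG-true {P} α Pg≡true rewrite Pg≡true = ∨-zeroʳ (P e)
  anyG-true {P} β Pg≡true rewrite Pg≡true | ∨-zeroʳ (P α) = ∨-zeroʳ (P e)
  anyG-true {P} γ Pg≡true rewrite Pg≡true | ∨-zeroʳ (P β) | ∨-zeroʳ (P α) = ∨-zeroʳ (P e)

  allG-false : ∀ {P} g → P g ≡ false → allG A P ≡ false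
  allG-false {P} e Pg≡false rewrite Pg≡false = refl
  allG-false {P} α Pg≡false rewrite Pg≡false = ∧-zeroʳ (P e)
  allG-false {P} β Pg≡false rewrite Pg≡false | ∧-zeroʳ (P α) = ∧-zeroʳ (P e)
  allG-false {P} γ Pg≡false rewrite Pg≡false | ∧-zeroʳ (P β) | ∧-zeroʳ (P α) = ∧-zeroʳ (P e)

  act-involutive : ∀ g x → act g (act g x) ≡ x
  act-involutive g x = begin
    act g (act g x)  ≡⟨ act-comp g g x ⟨
    act (g · g) x    ≡⟨ cong (λ k → act k x) (·-self g) ⟩
    act e x          ≡⟨ act-id x ⟩
    x                ∎
    where open ≡-Reasoning

  act-comm : ∀ g h x → act g (act h x) ≡ act h (act g x)
  act-comm g h x = begin
    act g (act h x)  ≡⟨ act-comp g h x ⟨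
    act (g · h) x    ≡⟨ cong (λ k → act k x) (·-comm g h) ⟩
    act (h · g) x    ≡⟨ act-comp h g x ⟩
    act h (act g x)  ∎
    where open ≡-Reasoning

  act-≡⇒fixes : ∀ g h x → act g x ≡ act h x → act (g · h) x ≡ x
  act-≡⇒fixes g h x gx≡hx = begin
    act (g · h) x    ≡⟨ act-comp g h x ⟩
    act g (act h x)  ≡⟨ cong (act g) gx≡hx ⟨
    act g (act g x)  ≡⟨ act-involutive g x ⟩
    x                ∎
    where open ≡-Reasoning

  fixes-act-invariant : ∀ g h x → ⌊ act g (act h x) ≟ act h x ⌋ ≡ ⌊ act g x ≟ x ⌋
  fixes-act-invariant g h x with act g x ≟ x
  ... | yes gx≡x = ⌊⌋-true (act g (act h x) ≟ act h x) (trans (act-comm g h x) (cong (act h) gx≡x))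
  ... | no  gx≢x = ⌊⌋-false (act g (act h x) ≟ act h x) λ fixes →
    gx≢x (begin
      act g x                     ≡⟨ act-involutive h (act g x) ⟨
      act h (act h (act g x))     ≡⟨ cong (act h) (act-comm g h x) ⟨
      act h (act g (act h x))     ≡⟨ cong (act h) fixes ⟩
      act h (act h x)             ≡⟨ act-involutive h x ⟩
      x                           ∎)
    where open ≡-Reasoning

  trivialOn≡fixes : ∀ g x → trivialOn A g x ≡ ⌊ act g x ≟ x ⌋
  trivialOn≡fixes g x = allG-const (λ h → fixes-act-invariant g h x)

  anyG-two : ∀ {P X Z} g₀ → P e ≡ X → P g₀ ≡ Z → (∀ g → P g ≡ X ⊎ P g ≡ Z) → anyG A P ≡ X ∨ Z
  anyG-two {P} {true}          g₀ Pe≡X _      _    rewrite Pe≡X = refl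
  anyG-two {P} {false} {true}  g₀ _    Pg₀≡Z _    = anyG-true {P} g₀ Pg₀≡Z
  anyG-two {P} {false} {false} g₀ _    _      P∈XZ = anyG-const {P} (reduce ∘ P∈XZ)

  allG-two : ∀ {P Z} g₀ → P g₀ ≡ Z → (∀ g → P g ≡ true ⊎ P g ≡ Z) → allG A P ≡ Z
  allG-two {P} {true}  g₀ _      P∈TZ = allG-const {P} (reduce ∘ P∈TZ)
  allG-two {P} {false} g₀ Pg₀≡Z _    = allG-false {P} g₀ Pg₀≡Z

  orbitSize-fixed : ∀ {x} → (∀ g → act g x ≡ x) → orbitSize A x ≡ 1
  orbitSize-fixed {x} fixed =
    trans (countB-cong (λ y → anyG-const (λ g → cong (λ u → ⌊ u ≟ y ⌋) (fixed g)))) (countB-≟ x)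

  orbitSize-free : ∀ {x} → act α x ≢ x → act β x ≢ x → act γ x ≢ x → orbitSize A x ≡ 4
  orbitSize-free {x} αx≢x βx≢x γx≢x rewrite act-id x =
    trans (countB-≟-∨ x _ x-new) (cong suc
      (trans (countB-≟-∨ (act α x) _ αx-new) (cong suc
        (trans (countB-≟-∨ (act β x) _ βx-new) (cong suc (countB-≟ (act γ x)))))))
    where
    x-new : ⌊ act α x ≟ x ⌋ ∨ (⌊ act β x ≟ x ⌋ ∨ ⌊ act γ x ≟ x ⌋) ≡ false
    x-new rewrite ⌊⌋-false (act α x ≟ x) αx≢x | ⌊⌋-false (act β x ≟ x) βx≢x
                | ⌊⌋-false (act γ x ≟ x) γx≢x = refl
    αx-new : ⌊ act β x ≟ act α x ⌋ ∨ ⌊ act γ x ≟ act α x ⌋ ≡ false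
    αx-new rewrite ⌊⌋-false (act β x ≟ act α x) (γx≢x ∘ act-≡⇒fixes β α x)
                 | ⌊⌋-false (act γ x ≟ act α x) (βx≢x ∘ act-≡⇒fixes γ α x) = refl
    βx-new : ⌊ act γ x ≟ act β x ⌋ ≡ false
    βx-new = ⌊⌋-false (act γ x ≟ act β x) (αx≢x ∘ act-≡⇒fixes γ β x)

  isOrbitOfType-moved : ∀ {g x} → act g x ≢ x → isOrbitOfType A g x ≡ false
  isOrbitOfType-moved {g} {x} gx≢x rewrite trivialOn≡fixes g x | ⌊⌋-false (act g x ≟ x) gx≢x
    | ∧-zeroʳ (orbitSize A x ≡ᵇ 2) = ∧-zeroʳ (isRep A x)

  isOrbitOfType-fixed : ∀ {g x} → (∀ h → act h x ≡ x) → isOrbitOfType A g x ≡ false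
  isOrbitOfType-fixed {g} {x} fixed rewrite orbitSize-fixed fixed = ∧-zeroʳ (isRep A x)

  splitsOrbit : V4 → (Fin n → Bool) → Fin n → Bool
  splitsOrbit g f x = isOrbitOfType A g x ∧ (countB (λ y → inOrbit A x y ∧ f y) ≡ᵇ 1)

  splitsOrbit-false : ∀ {g x} f → isOrbitOfType A g x ≡ false → splitsOrbit g f x ≡ false
  splitsOrbit-false f notType rewrite notType = refl

  record PairOrbit (x z : Fin n) : Set where
    field
      partner≢ : z ≢ x
      inOrbit-pair : ∀ y → inOrbit A x y ≡ ⌊ x ≟ y ⌋ ∨ ⌊ z ≟ y ⌋
      isRep-pair : isRep A x ≡ ⌊ x ≤? z ⌋
      partner-not-rep : x ≤ᶠ z → isRep A z ≡ false

    moves : ∀ {g} → act g x ≡ z → act g x ≢ x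
    moves gx≡z gx≡x = partner≢ (trans (sym gx≡z) gx≡x)

    countB-orbit : ∀ f → countB (λ y → inOrbit A x y ∧ f y) ≡ indicator (f x) + indicator (f z)
    countB-orbit f = trans (countB-cong (λ y → cong (_∧ f y) (inOrbit-pair y))) (countB-two partner≢ f)

    orbitSize-pair : orbitSize A x ≡ 2
    orbitSize-pair = trans (countB-cong (λ y → sym (∧-identityʳ (inOrbit A x y)))) (countB-orbit (λ _ → true))

    isOrbitOfType-pair : ∀ {g} → act g x ≡ x → isOrbitOfType A g x ≡ ⌊ x ≤? z ⌋
    isOrbitOfType-pair {g} gx≡x rewrite isRep-pair | orbitSize-pair | trivialOn≡fixes g x
      | ⌊⌋-true (act g x ≟ x) gx≡x = ∧-identityʳ ⌊ x ≤? z ⌋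

    splitsOrbit-pair : ∀ {g} → act g x ≡ x → ∀ f → splitsOrbit g f x ≡ ⌊ x ≤? z ⌋ ∧ (f x xor f z)
    splitsOrbit-pair gx≡x f rewrite isOrbitOfType-pair gx≡x | countB-orbit f =
      cong (⌊ x ≤? z ⌋ ∧_) (indicator-+≡ᵇ1 (f x) (f z))

  pairOrbit : ∀ {x z} g₀ → z ≢ x → act g₀ x ≡ z → (∀ g → act g x ≡ x ⊎ act g x ≡ z) → PairOrbit x z
  pairOrbit {x} {z} g₀ z≢x g₀x≡z orbit = record
    { partner≢        = z≢x
    ; inOrbit-pair    = λ y → anyG-two g₀ (cong (λ u → ⌊ u ≟ y ⌋) (act-id x)) (cong (λ u → ⌊ u ≟ y ⌋) g₀x≡z)
                                (λ g → Sum.map (cong (λ u → ⌊ u ≟ y ⌋)) (cong (λ u → ⌊ u ≟ y ⌋)) (orbit g))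
    ; isRep-pair      = allG-two g₀ (cong (λ u → ⌊ x ≤? u ⌋) g₀x≡z)
                          (λ g → Sum.map (λ gx≡x → trans (cong (λ u → ⌊ x ≤? u ⌋) gx≡x) (⌊⌋-true (x ≤? x) ≤-refl))
                                         (cong (λ u → ⌊ x ≤? u ⌋)) (orbit g))
    ; partner-not-rep = λ x≤z → allG-false {λ g → ⌊ z ≤? act g z ⌋} g₀
        (⌊⌋-false (z ≤? act g₀ z) (λ z≤g₀z → z≢x (≤-antisym (subst (z ≤ᶠ_) g₀z≡x z≤g₀z) x≤z)))
    }
    where
    g₀z≡x : act g₀ z ≡ x
    g₀z≡x = trans (cong (act g₀) (sym g₀x≡z)) (act-involutive g₀ x)

  data View (δ h k : V4) (x : Fin n) : Set where
    singleton : (∀ g → act g x ≡ x) → View δ h k x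
    pair₁ : ∀ {z} → PairOrbit x z → act δ x ≡ x → act h x ≡ z → act k x ≡ z → View δ h k x
    pair₂ : ∀ {z} → PairOrbit x z → act δ x ≡ z → act h x ≡ x → act k x ≡ z → View δ h k x
    pair₃ : ∀ {z} → PairOrbit x z → act δ x ≡ z → act h x ≡ z → act k x ≡ x → View δ h k x

  classify : NoOrbitOfLength4 A → ∀ x → View α β γ x
  classify no4 x with act α x ≟ x | act β x ≟ x | act γ x ≟ x
  ... | yes αx≡x | yes βx≡x | _ = singleton λ
    { e → act-id x ; α → αx≡x ; β → βx≡x ; γ → act-≡⇒fixes β α x (trans βx≡x (sym αx≡x)) }
  ... | yes αx≡x | no βx≢x | _ = pair₁ (pairOrbit β βx≢x refl orbit) αx≡x refl γx≡βx
    where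
    γx≡βx : act γ x ≡ act β x
    γx≡βx = trans (act-comp β α x) (cong (act β) αx≡x)
    orbit : ∀ g → act g x ≡ x ⊎ act g x ≡ act β x
    orbit = λ { e → inj₁ (act-id x) ; α → inj₁ αx≡x ; β → inj₂ refl ; γ → inj₂ γx≡βx }
  ... | no αx≢x | yes βx≡x | _ = pair₂ (pairOrbit α αx≢x refl orbit) refl βx≡x γx≡αx
    where
    γx≡αx : act γ x ≡ act α x
    γx≡αx = trans (act-comp α β x) (cong (act α) βx≡x)
    orbit : ∀ g → act g x ≡ x ⊎ act g x ≡ act α x
    orbit = λ { e → inj₁ (act-id x) ; α → inj₂ refl ; β → inj₁ βx≡x ; γ → inj₂ γx≡αx }
  ... | no αx≢x | no βx≢x | yes γx≡x = pair₃ (pairOrbit α αx≢x refl orbit) refl βx≡αx γx≡x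
    where
    βx≡αx : act β x ≡ act α x
    βx≡αx = trans (act-comp α γ x) (cong (act α) γx≡x)
    orbit : ∀ g → act g x ≡ x ⊎ act g x ≡ act α x
    orbit = λ { e → inj₁ (act-id x) ; α → inj₂ refl ; β → inj₂ βx≡αx ; γ → inj₁ γx≡x }
  ... | no αx≢x | no βx≢x | no γx≢x = ⊥-elim (no4 x (orbitSize-free αx≢x βx≢x γx≢x))

  view : ∀ {δ h k} → NoOrbitOfLength4 A → Others δ h k → ∀ x → View δ h k x
  view no4 α-βγ x = classify no4 x
  view no4 β-αγ x with classify no4 x
  ... | singleton fixed   = singleton fixed
  ... | pair₁ P αx βx γx = pair₂ P βx αx γx
  ... | pair₂ P αx βx γx = pair₁ P βx αx γx
  ... | pair₃ P αx βx γx = pair₃ P βx αx γx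
  view no4 γ-αβ x with classify no4 x
  ... | singleton fixed   = singleton fixed
  ... | pair₁ P αx βx γx = pair₂ P γx αx βx
  ... | pair₂ P αx βx γx = pair₃ P γx αx βx
  ... | pair₃ P αx βx γx = pair₁ P γx αx βx

  derivative : V4 → (Fin n → Bool) → Fin n → Bool
  derivative δ f x = f (act δ x) xor f x

  derivative-fixed : ∀ {δ x} f → act δ x ≡ x → derivative δ f x ≡ false
  derivative-fixed {δ} {x} f δx≡x = trans (cong (λ u → f u xor f x) δx≡x) (xor-same (f x))

  splitsOrbit-moved : ∀ {g x z} f → PairOrbit x z → act g x ≡ z → splitsOrbit g f x ≡ false
  splitsOrbit-moved f P gx≡z = splitsOrbit-false f (isOrbitOfType-moved (PairOrbit.moves P gx≡z))

  derivative-below-fixed : ∀ {δ x} f → act δ x ≡ x → indicator (derivative δ f x ∧ ⌊ x ≤? act δ x ⌋) ≡ 0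
  derivative-below-fixed {δ} {x} f δx≡x = cong (λ b → indicator (b ∧ ⌊ x ≤? act δ x ⌋)) (derivative-fixed f δx≡x)

  derivative-below-moved : ∀ {δ x z} f → act δ x ≡ z →
    indicator (derivative δ f x ∧ ⌊ x ≤? act δ x ⌋) ≡ indicator (⌊ x ≤? z ⌋ ∧ (f x xor f z))
  derivative-below-moved {x = x} {z} f δx≡z rewrite δx≡z =
    cong indicator (trans (∧-comm (f z xor f x) _) (cong (⌊ x ≤? z ⌋ ∧_) (xor-comm (f z) (f x))))

  splitsOrbit₂ : ∀ {h k} f x {a b} → splitsOrbit h f x ≡ a → splitsOrbit k f x ≡ b →
    indicator a + indicator b ≡ indicator (splitsOrbit h f x) + indicator (splitsOrbit k f x)
  splitsOrbit₂ f x hx≡a kx≡b = sym (cong₂ (λ a b → indicator a + indicator b) hx≡a kx≡b)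

  derivative-below≡splits : ∀ {δ h k} → NoOrbitOfLength4 A → Others δ h k → ∀ f x →
    indicator (derivative δ f x ∧ ⌊ x ≤? act δ x ⌋) ≡ indicator (splitsOrbit h f x) + indicator (splitsOrbit k f x)
  derivative-below≡splits {δ} no4 o f x with view no4 o x
  ... | singleton fixed  = trans (derivative-below-fixed f (fixed δ))
    (splitsOrbit₂ f x (splitsOrbit-false f (isOrbitOfType-fixed fixed))
                      (splitsOrbit-false f (isOrbitOfType-fixed fixed)))
  ... | pair₁ P δx hx kx = trans (derivative-below-fixed f δx)
    (splitsOrbit₂ f x (splitsOrbit-moved f P hx) (splitsOrbit-moved f P kx))
  ... | pair₂ P δx hx kx = trans (derivative-below-moved f δx) (trans (sym (+-identityʳ _))
    (splitsOrbit₂ f x (PairOrbit.splitsOrbit-pair P hx f) (splitsOrbit-moved f P kx)))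
  ... | pair₃ P δx hx kx = trans (derivative-below-moved f δx)
    (splitsOrbit₂ f x (splitsOrbit-moved f P hx) (PairOrbit.splitsOrbit-pair P kx f))

  countB-derivative : ∀ {δ h k} → NoOrbitOfLength4 A → Others δ h k → ∀ f →
    countB (derivative δ f) ≡ 2 * (μ A h f + μ A k f)
  countB-derivative {δ} no4 o f =
    trans (countB-involution-halves (act δ) (act-involutive δ) (derivative δ f) invariant fixed-free)
          (cong (2 *_) (countB-+ (derivative-below≡splits no4 o f)))
    where
    invariant : ∀ x → derivative δ f (act δ x) ≡ derivative δ f x
    invariant x rewrite act-involutive δ x = xor-comm (f x) (f (act δ x))

    fixed-free : ∀ x → derivative δ f x ≡ true → act δ x ≢ x
    fixed-free x changes δx≡x with trans (sym changes) (derivative-fixed f δx≡x)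
    ... | ()

  witness : ℕ → Fin n → Bool
  witness m x = takeTrues m (isOrbitOfType A α) x
              ∨ (takeTrues m (isOrbitOfType A β) x ∨ takeTrues m (isOrbitOfType A γ) x)

  witness-non-rep : ∀ m {z} → isRep A z ≡ false → witness m z ≡ false
  witness-non-rep m {z} notRep = cong₂ _∨_ (unmarked α) (cong₂ _∨_ (unmarked β) (unmarked γ))
    where
    unmarked : ∀ g → takeTrues m (isOrbitOfType A g) z ≡ false
    unmarked g = takeTrues-⊆ m (isOrbitOfType A g) z (cong (_∧ ((orbitSize A z ≡ᵇ 2) ∧ trivialOn A g z)) notRep)

  witness≡takeTrues : ∀ m {g h k x} → Others g h k → isOrbitOfType A h x ≡ false → isOrbitOfType A k x ≡ false →
    witness m x ≡ takeTrues m (isOrbitOfType A g) x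
  witness≡takeTrues m {x = x} α-βγ βx γx
    rewrite takeTrues-⊆ m (isOrbitOfType A β) x βx | takeTrues-⊆ m (isOrbitOfType A γ) x γx = ∨-identityʳ _
  witness≡takeTrues m {x = x} β-αγ αx γx
    rewrite takeTrues-⊆ m (isOrbitOfType A α) x αx | takeTrues-⊆ m (isOrbitOfType A γ) x γx = ∨-identityʳ _
  witness≡takeTrues m {x = x} γ-αβ αx βx
    rewrite takeTrues-⊆ m (isOrbitOfType A α) x αx | takeTrues-⊆ m (isOrbitOfType A β) x βx = refl

  splitsOrbit-witness-untyped : ∀ m {g x} → isOrbitOfType A g x ≡ false →
    splitsOrbit g (witness m) x ≡ takeTrues m (isOrbitOfType A g) x
  splitsOrbit-witness-untyped m {g} {x} notType =
    trans (splitsOrbit-false (witness m) notType) (sym (takeTrues-⊆ m _ x notType))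

  splitsOrbit-witness : ∀ m {g h k} → NoOrbitOfLength4 A → Others g h k → ∀ x →
    splitsOrbit g (witness m) x ≡ takeTrues m (isOrbitOfType A g) x
  splitsOrbit-witness m {g} no4 o x with view no4 o x
  ... | singleton fixed  = splitsOrbit-witness-untyped m (isOrbitOfType-fixed fixed)
  ... | pair₂ P gx hx kx = splitsOrbit-witness-untyped m (isOrbitOfType-moved (PairOrbit.moves P gx))
  ... | pair₃ P gx hx kx = splitsOrbit-witness-untyped m (isOrbitOfType-moved (PairOrbit.moves P gx))
  ... | pair₁ {z} P gx hx kx with x ≤? z
  ...   | no x≰z  =
    splitsOrbit-witness-untyped m (trans (PairOrbit.isOrbitOfType-pair P gx) (⌊⌋-false (x ≤? z) x≰z))
  ...   | yes x≤z = begin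
    splitsOrbit g (witness m) x                ≡⟨ PairOrbit.splitsOrbit-pair P gx (witness m) ⟩
    ⌊ x ≤? z ⌋ ∧ (witness m x xor witness m z) ≡⟨ cong₂ (λ b c → b ∧ (witness m x xor c)) (⌊⌋-true (x ≤? z) x≤z)
                                                   (witness-non-rep m (PairOrbit.partner-not-rep P x≤z)) ⟩
    witness m x xor false                      ≡⟨ xor-identityʳ (witness m x) ⟩
    witness m x                                ≡⟨ witness≡takeTrues m o (isOrbitOfType-moved (PairOrbit.moves P hx))
                                                                        (isOrbitOfType-moved (PairOrbit.moves P kx)) ⟩
    takeTrues m (isOrbitOfType A g) x          ∎
    where open ≡-Reasoning

  μ-witness : ∀ m {g h k} → NoOrbitOfLength4 A → Others g h k → μ A g (witness m) ≡ m ⊓ numOrbits A g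
  μ-witness m {g} no4 o =
    trans (countB-cong (splitsOrbit-witness m no4 o)) (countB-takeTrues m (isOrbitOfType A g))

  μ≤numOrbits : ∀ g f → μ A g f ≤ numOrbits A g
  μ≤numOrbits g f = countB-mono (λ x → ∧-conicalˡ (isOrbitOfType A g x) _)

  perfectNonlinear⇔balanced : ∀ f →
    PerfectNonlinear A f ⇔ (Balanced (derivative α f) × Balanced (derivative β f) × Balanced (derivative γ f))
  perfectNonlinear⇔balanced f = mk⇔ to from
    where
    to : PerfectNonlinear A f → Balanced (derivative α f) × Balanced (derivative β f) × Balanced (derivative γ f)
    to (2∣n , half) = balanced α (λ ()) , balanced β (λ ()) , balanced γ (λ ())
      where
      balanced : ∀ δ → δ ≢ e → Balanced (derivative δ f)
      balanced δ δ≢e = half⇒balanced 2∣n (half δ δ≢e true)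

    from : Balanced (derivative α f) × Balanced (derivative β f) × Balanced (derivative γ f) → PerfectNonlinear A f
    from (bα , bβ , bγ) = balanced⇒2∣n bα , half
      where
      half : ∀ δ → δ ≢ e → ∀ σ → countB (λ x → derivative δ f x ==ᵇ σ) ≡ n / 2
      half e e≢e = ⊥-elim (e≢e refl)
      half α _   = balanced⇒half bα
      half β _   = balanced⇒half bβ
      half γ _   = balanced⇒half bγ

  module _ (no4 : NoOrbitOfLength4 A) where

    balanced⇔pairSum : ∀ {δ h k} → Others δ h k → ∀ f → Balanced (derivative δ f) ⇔ 4 * (μ A h f + μ A k f) ≡ n
    balanced⇔pairSum {δ} {h} {k} o f = mk⇔ (trans (sym count)) (trans count)
      where
      count : 2 * countB (derivative δ f) ≡ 4 * (μ A h f + μ A k f)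
      count = trans (cong (2 *_) (countB-derivative no4 o f)) (sym (*-assoc 2 2 (μ A h f + μ A k f)))

    perfectNonlinear⇔eighths : ∀ f →
      PerfectNonlinear A f ⇔ (8 * μ A α f ≡ n × 8 * μ A β f ≡ n × 8 * μ A γ f ≡ n)
    perfectNonlinear⇔eighths f = ⇔-trans (perfectNonlinear⇔balanced f)
      (⇔-trans (balanced⇔pairSum α-βγ f ×-⇔ balanced⇔pairSum β-αγ f ×-⇔ balanced⇔pairSum γ-αβ f)
               (pairSums⇔eighths {n} {μ A α f} {μ A β f} {μ A γ f}))

    perfectNonlinear-exists⇔ : Σ (Fin n → Bool) (PerfectNonlinear A)
      ⇔ (8 ∣ n × n / 8 ≤ numOrbits A α ⊓ numOrbits A β ⊓ numOrbits A γ)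
    perfectNonlinear-exists⇔ = mk⇔ to from
      where
      to : Σ (Fin n → Bool) (PerfectNonlinear A) → 8 ∣ n × n / 8 ≤ numOrbits A α ⊓ numOrbits A β ⊓ numOrbits A γ
      to (f , pn) = necessary (Equivalence.to (perfectNonlinear⇔eighths f) pn)
        where
        bound : ∀ g → 8 * μ A g f ≡ n → n / 8 ≤ numOrbits A g
        bound g eg = subst (_≤ numOrbits A g) (m*n≡o⇒n≡o/m 8 eg) (μ≤numOrbits g f)

        necessary : 8 * μ A α f ≡ n × 8 * μ A β f ≡ n × 8 * μ A γ f ≡ n →
          8 ∣ n × n / 8 ≤ numOrbits A α ⊓ numOrbits A β ⊓ numOrbits A γ
        necessary (eα , eβ , eγ) = subst (8 ∣_) eα (m∣m*n (μ A α f)) ,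
          ⊓-glb {n / 8} {numOrbits A α ⊓ numOrbits A β} {numOrbits A γ}
            (⊓-glb {n / 8} {numOrbits A α} {numOrbits A β} (bound α eα) (bound β eβ)) (bound γ eγ)

      from : 8 ∣ n × n / 8 ≤ numOrbits A α ⊓ numOrbits A β ⊓ numOrbits A γ → Σ (Fin n → Bool) (PerfectNonlinear A)
      from (8∣n , bounds) = witness (n / 8) , Equivalence.from (perfectNonlinear⇔eighths (witness (n / 8)))
        (exact α-βγ (m≤n⊓o⇒m≤n (numOrbits A α) (numOrbits A β) αβ) ,
         exact β-αγ (m≤n⊓o⇒m≤o (numOrbits A α) (numOrbits A β) αβ) ,
         exact γ-αβ (m≤n⊓o⇒m≤o (numOrbits A α ⊓ numOrbits A β) (numOrbits A γ) bounds))
        where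
        αβ : n / 8 ≤ numOrbits A α ⊓ numOrbits A β
        αβ = m≤n⊓o⇒m≤n (numOrbits A α ⊓ numOrbits A β) (numOrbits A γ) bounds
        exact : ∀ {g h k} → Others g h k → n / 8 ≤ numOrbits A g → 8 * μ A g (witness (n / 8)) ≡ n
        exact {g} o enough = begin
          8 * μ A g (witness (n / 8))     ≡⟨ cong (8 *_) (μ-witness (n / 8) no4 o) ⟩
          8 * (n / 8 ⊓ numOrbits A g)     ≡⟨ cong (8 *_) (m≤n⇒m⊓n≡m enough) ⟩
          8 * (n / 8)                     ≡⟨ m*[n/m]≡n 8∣n ⟩
          n                               ∎
          where open ≡-Reasoning

theorem5p4 : (n : ℕ) (A : Action n) → NoOrbitOfLength4 A →
    ((Σ (Fin n → Bool) (λ f → PerfectNonlinear A f))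
      ⇔ ((8 ∣ n) × (n / 8 ≤ numOrbits A α ⊓ numOrbits A β ⊓ numOrbits A γ)))
    × ((f : Fin n → Bool) → PerfectNonlinear A f
      ⇔ ((8 * μ A α f ≡ n) × (8 * μ A β f ≡ n) × (8 * μ A γ f ≡ n)))
theorem5p4 n A no4 = perfectNonlinear-exists⇔ A no4 , perfectNonlinear⇔eighths A no4
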